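{- For every integer $k\geq 2$, the sequence $\{\rho_n^{ab}(\mathbf{t}^{(k)})\}_{n\geq 1}$ is ultimately periodic with period $k$.
   Context: Let $\Sigma_k=\{0,1,\dots,k-1\}$. Let $\sigma_k$ be the morphism on $\Sigma_k^*$ given by $\sigma_k(i)=i\,(i+1)\cdots(i+k-1)$ with all letters taken modulo $k$, and let $\mathbf{t}^{(k)}=\sigma_k^\infty(0)$ be its infinite fixed point beginning with $0$ (the generalized Thue-Morse sequence). For a word $v$, $\psi(v)=(|v|_0,\dots,|v|_{k-1})$ is its Parikh vector ($|v|_a$ = number of occurrences of $a$ in $v$). For an infinite word $\mathbf{w}$, $\mathcal{F}_n(\mathbf{w})$ is the set of its factors of length $n$, and $\rho_n^{ab}(\mathbf{w})=\#\{\psi(v): v\in\mathcal{F}_n(\mathbf{w})\}$ is its abelian complexity. -}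

module Defs where

open import Data.Nat using (ℕ; zero; suc; _+_; _≤_; NonZero)
open import Data.Nat.DivMod using (_%_)
open import Data.List using (List; []; _∷_; map; upTo; concatMap; length)
open import Data.Product using (Σ; ∃; _×_)
open import Relation.Binary.PropositionalEquality using (_≡_)
open import Data.List.Membership.Propositional using (_∈_)
open import Data.List.Relation.Unary.Unique.Propositional using (Unique)
open import Data.Nat using (_≟_)
open import Relation.Nullary using (yes; no)

-- Letters of Σ_k are the naturals 0..k-1.

σ : (k : ℕ) → .{{_ : NonZero k}} → ℕ → List ℕ
σ k i = map (λ j → (i + j) % k) (upTo k)

σ* : (k : ℕ) → .{{_ : NonZero k}} → List ℕ → List ℕ
σ* k = concatMap (σ k)

iter : (k : ℕ) → .{{_ : NonZero k}} → ℕ → List ℕ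
iter k zero    = 0 ∷ []
iter k (suc m) = σ* k (iter k m)

-- i-th letter of a word (0 if out of range; never used out of range below).
nth : List ℕ → ℕ → ℕ
nth []       _       = 0
nth (x ∷ xs) zero    = x
nth (x ∷ xs) (suc i) = nth xs i

-- The fixed point t^(k) = σ_k^∞(0): its i-th letter is the i-th letter of
-- σ_k^(i+1)(0), which has length k^(i+1) > i for k ≥ 2 and is a prefix of
-- all further iterates.
tm : (k : ℕ) → .{{_ : NonZero k}} → ℕ → ℕ
tm k i = nth (iter k (suc i)) i

occ : ℕ → List ℕ → ℕ
occ a []       = 0
occ a (x ∷ xs) with x ≟ a
... | yes _ = suc (occ a xs)
... | no  _ = occ a xs

ψ : (k : ℕ) → List ℕ → List ℕ
ψ k v = map (λ a → occ a v) (upTo k)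

factor : (ℕ → ℕ) → ℕ → ℕ → List ℕ
factor w i n = map (λ j → w (i + j)) (upTo n)

-- "ρ_n^{ab}(w) = m" (letters in Σ_k): there is a duplicate-free list of
-- exactly m vectors which is precisely the set {ψ(v) : v ∈ F_n(w)}.
IsAbelianComplexity : (k : ℕ) → (ℕ → ℕ) → ℕ → ℕ → Set
IsAbelianComplexity k w n m =
  Σ (List (List ℕ)) λ L →
    Unique L × length L ≡ m
    × (∀ i → ψ k (factor w i n) ∈ L)
    × (∀ p → p ∈ L → ∃ λ i → ψ k (factor w i n) ≡ p)

-- Write t for t^(k). Since σ_k(x) = x (x+1) … (x+k−1) mod k, the letter t(kq + a) is
-- t(q) + a mod k for a < k, and every block σ_k(x) contains each letter exactly once. So a factor
-- of length n starting at kq + a, with a + n = kM + b, consists of the tail of the block of t(q),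
-- M − 1 full blocks and the first b letters of the block of t(q + M); its Parikh vector is a
-- function (its profile) of the triple (a, t(q), t(q + M)). Every pair of letters occurs in t at
-- every distance M ≥ 1, so the Parikh vectors of length-n factors are exactly the profiles of
-- all k³ triples. For n ≥ k, replacing n by n + k adds one full block, i.e. adds 1 to every
-- coordinate of every profile; this injective shift preserves the number of distinct vectors.

module Submission where

open import Defs
open import Data.Nat
open import Data.Nat.Properties
open import Data.Nat.DivMod
open import Data.List
  using (List; []; _∷_; map; filter; upTo; applyUpTo; length; _++_; deduplicate; cartesianProduct)
open import Data.List.Properties
  using (filter-accept; filter-reject; length-++; length-map; length-applyUpTo; ≡-dec; map-∘; map-cong;
         map-cong-local; map-injective)
open import Data.Product using (Σ; ∃; _×_; _,_)
open import Function using (_∘_; id)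
open import Function.Definitions using (Injective)
open import Relation.Binary.Definitions using (DecidableEquality)
open import Relation.Binary.PropositionalEquality
open import Relation.Nullary using (yes; no; ¬?)
open import Data.Empty using (⊥-elim)
open import Induction.WellFounded using (Acc; acc)
import Data.List.Relation.Unary.All as All
open import Data.List.Membership.Propositional using (_∈_)
open import Data.List.Membership.Propositional.Properties
  using (∈-upTo⁺; ∈-upTo⁻; ∈-map⁺; ∈-map⁻; ∈-deduplicate⁺; ∈-deduplicate⁻;
         ∈-cartesianProduct⁺; ∈-cartesianProduct⁻)
open import Data.List.Relation.Unary.Unique.DecPropositional.Properties (≡-dec _≟_)
  using (deduplicate-!)
open import Data.Nat.Induction using (<-wellFounded)

module _ {a b} {A : Set a} {B : Set b} (_≟A_ : DecidableEquality A) (_≟B_ : DecidableEquality B)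
         {f : A → B} (f-inj : Injective _≡_ _≡_ f) where

  filter-map-injective : ∀ x ys →
    filter (λ y → ¬? (f x ≟B y)) (map f ys) ≡ map f (filter (λ y → ¬? (x ≟A y)) ys)
  filter-map-injective x [] = refl
  filter-map-injective x (y ∷ ys) with x ≟A y
  ... | yes refl = trans (filter-reject (λ y → ¬? (f x ≟B y)) (λ ne → ne refl))
                         (filter-map-injective x ys)
  ... | no  x≢y  = trans (filter-accept (λ y → ¬? (f x ≟B y)) (λ e → x≢y (f-inj e)))
                         (cong (f y ∷_) (filter-map-injective x ys))

  deduplicate-map-injective : ∀ xs → deduplicate _≟B_ (map f xs) ≡ map f (deduplicate _≟A_ xs)
  deduplicate-map-injective [] = refl
  deduplicate-map-injective (x ∷ xs) = cong (f x ∷_)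
    (trans (cong (filter (λ y → ¬? (f x ≟B y))) (deduplicate-map-injective xs))
           (filter-map-injective x (deduplicate _≟A_ xs)))

count : (ℕ → ℕ) → ℕ → ℕ → ℕ
count f zero    c = 0
count f (suc n) c with f 0 ≟ c
... | yes _ = suc (count (f ∘ suc) n c)
... | no  _ = count (f ∘ suc) n c

occ-map-applyUpTo : ∀ (f g : ℕ → ℕ) n c → occ c (map f (applyUpTo g n)) ≡ count (f ∘ g) n c
occ-map-applyUpTo f g zero    c = refl
occ-map-applyUpTo f g (suc n) c with f (g 0) ≟ c
... | yes _ = cong suc (occ-map-applyUpTo f (g ∘ suc) n c)
... | no  _ = occ-map-applyUpTo f (g ∘ suc) n c

count-cong : ∀ {f g : ℕ → ℕ} n c → (∀ j → j < n → f j ≡ g j) → count f n c ≡ count g n c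
count-cong zero c f≗g = refl
count-cong {f} {g} (suc n) c f≗g with f 0 ≟ c | g 0 ≟ c
... | yes _   | yes _   = cong suc (count-cong n c (λ j j<n → f≗g (suc j) (s≤s j<n)))
... | no  _   | no  _   = count-cong n c (λ j j<n → f≗g (suc j) (s≤s j<n))
... | yes f≡c | no  g≢c = ⊥-elim (g≢c (trans (sym (f≗g 0 z<s)) f≡c))
... | no  f≢c | yes g≡c = ⊥-elim (f≢c (trans (f≗g 0 z<s) g≡c))

count-+ : ∀ f m n c → count f (m + n) c ≡ count f m c + count (λ j → f (m + j)) n c
count-+ f zero    n c = refl
count-+ f (suc m) n c with f 0 ≟ c
... | yes _ = cong suc (count-+ (f ∘ suc) m n c)
... | no  _ = count-+ (f ∘ suc) m n c

count-here : ∀ f n {c} → f 0 ≡ c → count f (suc n) c ≡ suc (count (f ∘ suc) n c)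
count-here f n {c} f0≡c with f 0 ≟ c
... | yes _     = refl
... | no  f0≢c = ⊥-elim (f0≢c f0≡c)

count-none : ∀ f n {c} → (∀ j → j < n → f j ≢ c) → count f n c ≡ 0
count-none f zero    f≢c = refl
count-none f (suc n) {c} f≢c with f 0 ≟ c
... | yes f0≡c = ⊥-elim (f≢c 0 z<s f0≡c)
... | no  _    = count-none (f ∘ suc) n (λ j j<n → f≢c (suc j) (s≤s j<n))

count-id : ∀ {n c} → c < n → count id n c ≡ 1
count-id {n} {c} c<n = begin
  count id n c                            ≡⟨ cong (λ m → count id m c) n≡c+[1+m] ⟩
  count id (c + suc m) c                  ≡⟨ count-+ id c (suc m) c ⟩
  count id c c + count (c +_) (suc m) c   ≡⟨ cong₂ _+_ (count-none id c (λ j j<c → <⇒≢ j<c))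
                                                       (count-here (c +_) m (+-identityʳ c)) ⟩
  suc (count (λ j → c + suc j) m c)       ≡⟨ cong suc (count-none _ m (λ j _ → >⇒≢ (m<m+n c z<s))) ⟩
  1                                       ∎
  where
  open ≡-Reasoning
  m = n ∸ suc c
  n≡c+[1+m] : n ≡ c + suc m
  n≡c+[1+m] = trans (sym (m+[n∸m]≡n c<n)) (sym (+-suc c m))

count-rotate : ∀ f n c → f n ≡ f 0 → count (f ∘ suc) n c ≡ count f n c
count-rotate f n c fn≡f0 = +-cancelˡ-≡ (count f 1 c) _ _ (begin
  count f 1 c + count (f ∘ suc) n c           ≡⟨ count-+ f 1 n c ⟨
  count f (suc n) c                           ≡⟨ cong (λ m → count f m c) (+-comm 1 n) ⟩
  count f (n + 1) c                           ≡⟨ count-+ f n 1 c ⟩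
  count f n c + count (λ j → f (n + j)) 1 c   ≡⟨ cong (count f n c +_) (count-cong 1 c last≡first) ⟩
  count f n c + count f 1 c                   ≡⟨ +-comm (count f n c) _ ⟩
  count f 1 c + count f n c                   ∎)
  where
  open ≡-Reasoning
  last≡first : ∀ j → j < 1 → f (n + j) ≡ f j
  last≡first zero    _ = trans (cong f (+-identityʳ n)) fn≡f0
  last≡first (suc j) (s≤s ())

nth-++ˡ : ∀ (l r : List ℕ) {j} → j < length l → nth (l ++ r) j ≡ nth l j
nth-++ˡ (x ∷ l) r {zero}  _         = refl
nth-++ˡ (x ∷ l) r {suc j} (s≤s j<l) = nth-++ˡ l r j<l

nth-++ʳ : ∀ (l r : List ℕ) j → nth (l ++ r) (length l + j) ≡ nth r j
nth-++ʳ []      r j = refl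
nth-++ʳ (x ∷ l) r j = nth-++ʳ l r j

nth-map-applyUpTo : ∀ (f g : ℕ → ℕ) {n j} → j < n → nth (map f (applyUpTo g n)) j ≡ f (g j)
nth-map-applyUpTo f g {suc n} {zero}  _         = refl
nth-map-applyUpTo f g {suc n} {suc j} (s≤s j<n) = nth-map-applyUpTo f (g ∘ suc) j<n

module ThueMorse (k : ℕ) .{{_ : NonZero k}} (1<k : 1 < k) where

  t : ℕ → ℕ
  t = tm k

  0<k : 0 < k
  0<k = <-trans z<s 1<k

  j≡k*[j/k]+j%k : ∀ j → j ≡ k * (j / k) + j % k
  j≡k*[j/k]+j%k j = trans (m≡m%n+[m/n]*n j k) (trans (+-comm (j % k) _) (cong (_+ j % k) (*-comm (j / k) k)))

  [m%k+n]%k≡[m+n]%k : ∀ m n → (m % k + n) % k ≡ (m + n) % k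
  [m%k+n]%k≡[m+n]%k m n = begin
    (m % k + n) % k          ≡⟨ %-distribˡ-+ (m % k) n k ⟩
    (m % k % k + n % k) % k  ≡⟨ cong (λ z → (z + n % k) % k) (m%n%n≡m%n m k) ⟩
    (m % k + n % k) % k      ≡⟨ %-distribˡ-+ m n k ⟨
    (m + n) % k              ∎
    where open ≡-Reasoning

  [m+k]%k≡m : ∀ {m} → m < k → (m + k) % k ≡ m
  [m+k]%k≡m {m} m<k = trans ([m+n]%n≡m%n m k) (m<n⇒m%n≡m m<k)

  [[m+n]%k+o]%k≡m : ∀ {m} n {o} → m < k → n + o ≡ k → ((m + n) % k + o) % k ≡ m
  [[m+n]%k+o]%k≡m {m} n {o} m<k n+o≡k = begin
    ((m + n) % k + o) % k   ≡⟨ [m%k+n]%k≡[m+n]%k (m + n) o ⟩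
    (m + n + o) % k         ≡⟨ cong (_% k) (trans (+-assoc m n o) (cong (m +_) n+o≡k)) ⟩
    (m + k) % k             ≡⟨ [m+k]%k≡m m<k ⟩
    m                       ∎
    where open ≡-Reasoning

  k*0+b≡b : ∀ b → k * 0 + b ≡ b
  k*0+b≡b b = cong (_+ b) (*-zeroʳ k)

  k*q+k≡k*[1+q] : ∀ q → k * q + k ≡ k * suc q
  k*q+k≡k*[1+q] q = trans (+-comm (k * q) k) (sym (*-suc k q))

  n<k^n : ∀ n → n < k ^ n
  n<k^n zero    = z<s
  n<k^n (suc n) = begin-strict
    suc n              ≤⟨ n<k^n n ⟩
    k ^ n              <⟨ m<m+n (k ^ n) (m^n>0 k n) ⟩
    k ^ n + k ^ n      ≡⟨ cong (k ^ n +_) (+-identityʳ (k ^ n)) ⟨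
    2 * k ^ n          ≤⟨ *-monoˡ-≤ (k ^ n) 1<k ⟩
    k * k ^ n          ∎
    where open ≤-Reasoning

  n<k^[1+n] : ∀ n → n < k ^ suc n
  n<k^[1+n] n = <-trans (n<k^n n) (^-monoʳ-< k 1<k (n<1+n n))

  length-σ : ∀ x → length (σ k x) ≡ k
  length-σ x = trans (length-map _ (upTo k)) (length-applyUpTo id k)

  length-σ* : ∀ w → length (σ* k w) ≡ k * length w
  length-σ* []      = sym (*-zeroʳ k)
  length-σ* (x ∷ w) = begin
    length (σ k x ++ σ* k w)             ≡⟨ length-++ (σ k x) ⟩
    length (σ k x) + length (σ* k w)     ≡⟨ cong₂ _+_ (length-σ x) (length-σ* w) ⟩
    k + k * length w                     ≡⟨ *-suc k (length w) ⟨
    k * suc (length w)                   ∎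
    where open ≡-Reasoning

  length-iter : ∀ m → length (iter k m) ≡ k ^ m
  length-iter zero    = refl
  length-iter (suc m) = trans (length-σ* (iter k m)) (cong (k *_) (length-iter m))

  nth-σ* : ∀ w {q a} → q < length w → a < k → nth (σ* k w) (k * q + a) ≡ (nth w q + a) % k
  nth-σ* (x ∷ w) {zero} {a} _ a<k = begin
    nth (σ k x ++ σ* k w) (k * 0 + a)    ≡⟨ cong (nth (σ k x ++ σ* k w)) (k*0+b≡b a) ⟩
    nth (σ k x ++ σ* k w) a              ≡⟨ nth-++ˡ (σ k x) _ (subst (a <_) (sym (length-σ x)) a<k) ⟩
    nth (σ k x) a                        ≡⟨ nth-map-applyUpTo (λ j → (x + j) % k) id a<k ⟩
    (x + a) % k                          ∎
    where open ≡-Reasoning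
  nth-σ* (x ∷ w) {suc q} {a} (s≤s q<w) a<k = begin
    nth (σ k x ++ σ* k w) (k * suc q + a)                  ≡⟨ cong (nth (σ k x ++ σ* k w)) index ⟩
    nth (σ k x ++ σ* k w) (length (σ k x) + (k * q + a))   ≡⟨ nth-++ʳ (σ k x) _ _ ⟩
    nth (σ* k w) (k * q + a)                               ≡⟨ nth-σ* w q<w a<k ⟩
    (nth w q + a) % k                                      ∎
    where
    open ≡-Reasoning
    index : k * suc q + a ≡ length (σ k x) + (k * q + a)
    index = trans (cong (_+ a) (*-suc k q))
                  (trans (+-assoc k (k * q) a) (cong (_+ (k * q + a)) (sym (length-σ x))))

  nth-iter-suc : ∀ m {j} → j < k ^ m → nth (iter k (suc m)) j ≡ nth (iter k m) j
  nth-iter-suc zero {zero} _ = begin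
    nth (σ* k (0 ∷ [])) 0             ≡⟨ cong (nth (σ* k (0 ∷ []))) (k*0+b≡b 0) ⟨
    nth (σ* k (0 ∷ [])) (k * 0 + 0)   ≡⟨ nth-σ* (0 ∷ []) z<s 0<k ⟩
    0 % k                             ≡⟨ m<n⇒m%n≡m 0<k ⟩
    0                                 ∎
    where open ≡-Reasoning
  nth-iter-suc zero {suc j} (s≤s ())
  nth-iter-suc (suc m) {j} j<k^[1+m] = begin
    nth (iter k (suc (suc m))) j            ≡⟨ cong (nth (iter k (suc (suc m)))) (j≡k*[j/k]+j%k j) ⟩
    nth (σ* k (iter k (suc m))) (k * q + a) ≡⟨ nth-σ* (iter k (suc m)) (q<length (suc m) q<k^[1+m]) a<k ⟩
    (nth (iter k (suc m)) q + a) % k        ≡⟨ cong (λ z → (z + a) % k) (nth-iter-suc m q<k^m) ⟩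
    (nth (iter k m) q + a) % k              ≡⟨ nth-σ* (iter k m) (q<length m q<k^m) a<k ⟨
    nth (σ* k (iter k m)) (k * q + a)       ≡⟨ cong (nth (iter k (suc m))) (j≡k*[j/k]+j%k j) ⟨
    nth (iter k (suc m)) j                  ∎
    where
    open ≡-Reasoning
    q = j / k
    a = j % k
    a<k : a < k
    a<k = m%n<n j k
    q<k^m : q < k ^ m
    q<k^m = m<n*o⇒m/o<n (subst (j <_) (*-comm k (k ^ m)) j<k^[1+m])
    q<k^[1+m] : q < k ^ suc m
    q<k^[1+m] = <-≤-trans q<k^m (^-monoʳ-≤ k (n≤1+n m))
    q<length : ∀ m′ → q < k ^ m′ → q < length (iter k m′)
    q<length m′ = subst (q <_) (sym (length-iter m′))

  nth-iter-+ : ∀ d m {j} → j < k ^ m → nth (iter k (d + m)) j ≡ nth (iter k m) j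
  nth-iter-+ zero    m j<k^m = refl
  nth-iter-+ (suc d) m j<k^m =
    trans (nth-iter-suc (d + m) (<-≤-trans j<k^m (^-monoʳ-≤ k (m≤n+m m d)))) (nth-iter-+ d m j<k^m)

  tm-nth : ∀ m {j} → j < k ^ m → t j ≡ nth (iter k m) j
  tm-nth m {j} j<k^m = begin
    nth (iter k (suc j)) j       ≡⟨ nth-iter-+ m (suc j) (n<k^[1+n] j) ⟨
    nth (iter k (m + suc j)) j   ≡⟨ cong (λ z → nth (iter k z) j) (+-comm m (suc j)) ⟩
    nth (iter k (suc j + m)) j   ≡⟨ nth-iter-+ (suc j) m j<k^m ⟩
    nth (iter k m) j             ∎
    where open ≡-Reasoning

  tm-digit : ∀ q {a} → a < k → t (k * q + a) ≡ (t q + a) % k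
  tm-digit q {a} a<k = trans (tm-nth (suc (suc q)) bound)
    (nth-σ* (iter k (suc q)) (subst (q <_) (sym (length-iter (suc q))) (n<k^[1+n] q)) a<k)
    where
    bound : k * q + a < k * k ^ suc q
    bound = begin-strict
      k * q + a     <⟨ +-monoʳ-< (k * q) a<k ⟩
      k * q + k     ≡⟨ k*q+k≡k*[1+q] q ⟩
      k * suc q     ≤⟨ *-monoʳ-≤ k (<⇒≤ (n<k^n (suc q))) ⟩
      k * k ^ suc q ∎
      where open ≤-Reasoning

  tm<k : ∀ i → t i < k
  tm<k i = subst (λ z → t z < k) (sym (j≡k*[j/k]+j%k i))
    (subst (_< k) (sym (tm-digit (i / k) (m%n<n i k))) (m%n<n (t (i / k) + i % k) k))

  tm-zero : t 0 ≡ 0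
  tm-zero = nth-iter-suc 0 z<s

  tm-small : ∀ {a} → a < k → t a ≡ a
  tm-small {a} a<k = begin
    t a                ≡⟨ cong t (k*0+b≡b a) ⟨
    t (k * 0 + a)      ≡⟨ tm-digit 0 a<k ⟩
    (t 0 + a) % k      ≡⟨ cong (λ z → (z + a) % k) tm-zero ⟩
    a % k              ≡⟨ m<n⇒m%n≡m a<k ⟩
    a                  ∎
    where open ≡-Reasoning

  tm-k* : ∀ q → t (k * q) ≡ t q
  tm-k* q = begin
    t (k * q)          ≡⟨ cong t (+-identityʳ (k * q)) ⟨
    t (k * q + 0)      ≡⟨ tm-digit q 0<k ⟩
    (t q + 0) % k      ≡⟨ cong (_% k) (+-identityʳ (t q)) ⟩
    t q % k            ≡⟨ m<n⇒m%n≡m (tm<k q) ⟩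
    t q                ∎
    where open ≡-Reasoning

  countAscending : ℕ → ℕ → ℕ → ℕ
  countAscending x l c = count (λ j → (x + j) % k) l c

  countAscending-full : ∀ x {c} → c < k → countAscending x k c ≡ 1
  countAscending-full zero    {c} c<k =
    trans (count-cong k c (λ j j<k → m<n⇒m%n≡m j<k)) (count-id c<k)
  countAscending-full (suc x) {c} c<k = begin
    count (λ j → (suc x + j) % k) k c   ≡⟨ count-cong k c (λ j _ → cong (_% k) (+-suc x j)) ⟨
    count (f ∘ suc) k c                 ≡⟨ count-rotate f k c periodic ⟩
    countAscending x k c                ≡⟨ countAscending-full x c<k ⟩
    1                                   ∎
    where
    open ≡-Reasoning
    f : ℕ → ℕ
    f j = (x + j) % k
    periodic : f k ≡ f 0
    periodic = trans ([m+n]%n≡m%n x k) (cong (_% k) (sym (+-identityʳ x)))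

  count-blocks : ∀ r p {b c} → b ≤ k → c < k →
    count (λ j → t (k * p + j)) (k * r + b) c ≡ r + countAscending (t (p + r)) b c
  count-blocks zero p {b} {c} b≤k c<k = begin
    count (λ j → t (k * p + j)) (k * 0 + b) c
      ≡⟨ cong (λ z → count (λ j → t (k * p + j)) z c) (k*0+b≡b b) ⟩
    count (λ j → t (k * p + j)) b c
      ≡⟨ count-cong b c (λ j j<b → tm-digit p (<-≤-trans j<b b≤k)) ⟩
    countAscending (t p) b c
      ≡⟨ cong (λ z → countAscending (t z) b c) (+-identityʳ p) ⟨
    countAscending (t (p + 0)) b c
      ∎
    where open ≡-Reasoning
  count-blocks (suc r) p {b} {c} b≤k c<k = begin
    count f (k * suc r + b) c                                 ≡⟨ cong (λ z → count f z c) length≡ ⟩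
    count f (k + (k * r + b)) c                               ≡⟨ count-+ f k (k * r + b) c ⟩
    count f k c + count (λ j → f (k + j)) (k * r + b) c       ≡⟨ cong₂ _+_ first-block rest ⟩
    1 + (r + countAscending (t (suc p + r)) b c)
      ≡⟨ cong (λ z → suc (r + countAscending (t z) b c)) (+-suc p r) ⟨
    suc r + countAscending (t (p + suc r)) b c                ∎
    where
    open ≡-Reasoning
    f : ℕ → ℕ
    f j = t (k * p + j)
    length≡ : k * suc r + b ≡ k + (k * r + b)
    length≡ = trans (cong (_+ b) (*-suc k r)) (+-assoc k (k * r) b)
    first-block : count f k c ≡ 1
    first-block = trans (count-cong k c (λ j j<k → tm-digit p j<k)) (countAscending-full (t p) c<k)
    rest : count (λ j → f (k + j)) (k * r + b) c ≡ r + countAscending (t (suc p + r)) b c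
    rest = trans (count-cong (k * r + b) c (λ j _ → cong t (index j))) (count-blocks r (suc p) b≤k c<k)
      where
      index : ∀ j → k * p + (k + j) ≡ k * suc p + j
      index j = trans (sym (+-assoc (k * p) k j)) (cong (_+ j) (k*q+k≡k*[1+q] p))

  -- Letter counts of a factor of length n that starts at offset a of the block σ(x) and
  -- crosses M block boundaries, ending b letters into the block σ(y) when M ≥ 1.
  crossing : (a n M b x y : ℕ) → ℕ → ℕ
  crossing a n zero    b x y c = countAscending (x + a) n c
  crossing a n (suc M) b x y c = countAscending (x + a) (k ∸ a) c + (M + countAscending y b c)

  tm-within-block : ∀ q {a j} → a + j < k → t (k * q + a + j) ≡ (t q + a + j) % k
  tm-within-block q {a} {j} a+j<k = begin
    t (k * q + a + j)      ≡⟨ cong t (+-assoc (k * q) a j) ⟩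
    t (k * q + (a + j))    ≡⟨ tm-digit q a+j<k ⟩
    (t q + (a + j)) % k    ≡⟨ cong (_% k) (+-assoc (t q) a j) ⟨
    (t q + a + j) % k      ∎
    where open ≡-Reasoning

  count-factor : ∀ q {a n} M {b c} → a < k → b < k → c < k → a + n ≡ k * M + b →
    count (λ j → t (k * q + a + j)) n c ≡ crossing a n M b (t q) (t (q + M)) c
  count-factor q {a} {n} zero {b} {c} a<k b<k c<k a+n≡b =
    count-cong n c (λ j j<n → tm-within-block q (begin-strict
      a + j          <⟨ +-monoʳ-< a j<n ⟩
      a + n          ≡⟨ a+n≡b ⟩
      k * 0 + b      ≡⟨ k*0+b≡b b ⟩
      b              <⟨ b<k ⟩
      k              ∎))
    where open ≤-Reasoning
  count-factor q {a} {n} (suc M) {b} {c} a<k b<k c<k a+n≡ = begin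
    count f n c                                               ≡⟨ cong (λ z → count f z c) n≡ ⟩
    count f ((k ∸ a) + rest) c                                ≡⟨ count-+ f (k ∸ a) rest c ⟩
    count f (k ∸ a) c + count (λ j → f (k ∸ a + j)) rest c   ≡⟨ cong₂ _+_ first-block later-blocks ⟩
    countAscending (t q + a) (k ∸ a) c + (M + countAscending (t (suc q + M)) b c)
      ≡⟨ cong (λ z → countAscending (t q + a) (k ∸ a) c + (M + countAscending (t z) b c)) (+-suc q M) ⟨
    crossing a n (suc M) b (t q) (t (q + suc M)) c            ∎
    where
    open ≡-Reasoning
    f : ℕ → ℕ
    f j = t (k * q + a + j)
    rest = k * M + b
    n≡ : n ≡ (k ∸ a) + rest
    n≡ = begin
      n                        ≡⟨ m+n∸m≡n a n ⟨
      a + n ∸ a                ≡⟨ cong (_∸ a) a+n≡ ⟩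
      k * suc M + b ∸ a        ≡⟨ cong (λ z → z + b ∸ a) (*-suc k M) ⟩
      k + k * M + b ∸ a        ≡⟨ cong (_∸ a) (+-assoc k (k * M) b) ⟩
      k + rest ∸ a             ≡⟨ +-∸-comm rest (<⇒≤ a<k) ⟩
      (k ∸ a) + rest           ∎
    first-block : count f (k ∸ a) c ≡ countAscending (t q + a) (k ∸ a) c
    first-block = count-cong (k ∸ a) c (λ j j<k∸a →
      tm-within-block q (subst (a + j <_) (m+[n∸m]≡n (<⇒≤ a<k)) (+-monoʳ-< a j<k∸a)))
    index : ∀ j → k * q + a + ((k ∸ a) + j) ≡ k * suc q + j
    index j = begin
      k * q + a + ((k ∸ a) + j)    ≡⟨ +-assoc (k * q) a _ ⟩
      k * q + (a + ((k ∸ a) + j))  ≡⟨ cong (k * q +_) (+-assoc a (k ∸ a) j) ⟨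
      k * q + (a + (k ∸ a) + j)    ≡⟨ cong (λ z → k * q + (z + j)) (m+[n∸m]≡n (<⇒≤ a<k)) ⟩
      k * q + (k + j)              ≡⟨ +-assoc (k * q) k j ⟨
      k * q + k + j                ≡⟨ cong (_+ j) (k*q+k≡k*[1+q] q) ⟩
      k * suc q + j                ∎
    later-blocks : count (λ j → f (k ∸ a + j)) rest c ≡ M + countAscending (t (suc q + M)) b c
    later-blocks = trans (count-cong rest c (λ j _ → cong t (index j)))
                         (count-blocks M (suc q) (<⇒≤ b<k) c<k)

  profile : ℕ → ℕ × ℕ × ℕ → List ℕ
  profile n (a , x , y) = map (crossing a n ((a + n) / k) ((a + n) % k) x y) (upTo k)

  ψ-factor : ∀ q {a} n → a < k →
    ψ k (factor t (k * q + a) n) ≡ profile n (a , t q , t (q + (a + n) / k))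
  ψ-factor q {a} n a<k = map-cong-local (All.tabulate λ {c} c∈ →
    trans (occ-map-applyUpTo (λ j → t (k * q + a + j)) id n c)
          (count-factor q ((a + n) / k) a<k (m%n<n (a + n) k) (∈-upTo⁻ c∈) (j≡k*[j/k]+j%k (a + n))))

  profile-unchanged : ∀ n {a x y y′} → (a + n) / k ≡ 0 →
    profile n (a , x , y) ≡ profile n (a , x , y′)
  profile-unchanged n {a} {x} {y} {y′} no-crossing =
    trans (cong (λ M → map (crossing a n M b x y) (upTo k)) no-crossing)
          (cong (λ M → map (crossing a n M b x y′) (upTo k)) (sym no-crossing))
    where b = (a + n) % k

  PairAtDistance : ℕ → ℕ → ℕ → Set
  PairAtDistance M x y = ∃ λ q → t q ≡ x × t (q + M) ≡ y

  pairAtDistance-within : ∀ {M x y} → 0 < M → M ≤ k → x < k →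
    PairAtDistance 1 ((x + M) % k) y → PairAtDistance M x y
  pairAtDistance-within {M} {x} {y} 0<M M≤k x<k (p , tp≡x+M , t[p+1]≡y) =
    k * p + (k ∸ M) , first , second
    where
    open ≡-Reasoning
    first : t (k * p + (k ∸ M)) ≡ x
    first = begin
      t (k * p + (k ∸ M))               ≡⟨ tm-digit p (∸-monoʳ-< 0<M M≤k) ⟩
      (t p + (k ∸ M)) % k               ≡⟨ cong (λ z → (z + (k ∸ M)) % k) tp≡x+M ⟩
      ((x + M) % k + (k ∸ M)) % k       ≡⟨ [[m+n]%k+o]%k≡m M x<k (m+[n∸m]≡n M≤k) ⟩
      x                                 ∎
    second : t (k * p + (k ∸ M) + M) ≡ y
    second = begin
      t (k * p + (k ∸ M) + M)
        ≡⟨ cong t (trans (+-assoc (k * p) (k ∸ M) M) (cong (k * p +_) (m∸n+n≡m M≤k))) ⟩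
      t (k * p + k)
        ≡⟨ cong t (trans (k*q+k≡k*[1+q] p) (cong (k *_) (+-comm 1 p))) ⟩
      t (k * (p + 1))                   ≡⟨ tm-k* (p + 1) ⟩
      t (p + 1)                         ≡⟨ t[p+1]≡y ⟩
      y                                 ∎

  pairAtDistance-scale : ∀ {M x y b} → b < k → y < k →
    PairAtDistance M x ((y + (k ∸ b)) % k) → PairAtDistance (k * M + b) x y
  pairAtDistance-scale {M} {x} {y} {b} b<k y<k (p , tp≡x , t[p+M]≡y′) =
    k * p , trans (tm-k* p) tp≡x , (begin
    t (k * p + (k * M + b))
      ≡⟨ cong t (trans (cong (_+ b) (*-distribˡ-+ k p M)) (+-assoc (k * p) (k * M) b)) ⟨
    t (k * (p + M) + b)                     ≡⟨ tm-digit (p + M) b<k ⟩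
    (t (p + M) + b) % k                     ≡⟨ cong (λ z → (z + b) % k) t[p+M]≡y′ ⟩
    ((y + (k ∸ b)) % k + b) % k             ≡⟨ [[m+n]%k+o]%k≡m (k ∸ b) y<k (m∸n+n≡m (<⇒≤ b<k)) ⟩
    y                                       ∎)
    where open ≡-Reasoning

  -- The witness ends in s base-k digits k − 1, each of which adds 1 to t (q + 1) − t q mod k.
  adjacentPair-gap : ∀ s {x y} → x < k → (x + suc s) % k ≡ y → PairAtDistance 1 x y
  adjacentPair-gap zero {x} {y} x<k x+1≡y = k * x , trans (tm-k* x) (tm-small x<k) , (begin
    t (k * x + 1)       ≡⟨ tm-digit x 1<k ⟩
    (t x + 1) % k       ≡⟨ cong (λ z → (z + 1) % k) (tm-small x<k) ⟩
    (x + 1) % k         ≡⟨ x+1≡y ⟩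
    y                   ∎)
    where open ≡-Reasoning
  adjacentPair-gap (suc s) {x} {y} x<k gap =
    pairAtDistance-within z<s 0<k x<k (adjacentPair-gap s (m%n<n (x + 1) k) gap′)
    where
    gap′ : ((x + 1) % k + suc s) % k ≡ y
    gap′ = trans ([m%k+n]%k≡[m+n]%k (x + 1) (suc s)) (trans (cong (_% k) (+-assoc x 1 (suc s))) gap)

  adjacentPair : ∀ {x y} → x < k → y < k → PairAtDistance 1 x y
  adjacentPair {x} {y} x<k y<k =
    adjacentPair-gap (y + (k ∸ suc x)) x<k (trans (cong (_% k) sum≡) ([m+k]%k≡m y<k))
    where
    sum≡ : x + suc (y + (k ∸ suc x)) ≡ y + k
    sum≡ = begin
      x + suc (y + (k ∸ suc x))     ≡⟨ +-suc x _ ⟩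
      suc x + (y + (k ∸ suc x))     ≡⟨ +-assoc (suc x) y _ ⟨
      suc x + y + (k ∸ suc x)       ≡⟨ cong (_+ (k ∸ suc x)) (+-comm (suc x) y) ⟩
      y + suc x + (k ∸ suc x)       ≡⟨ +-assoc y (suc x) _ ⟩
      y + (suc x + (k ∸ suc x))     ≡⟨ cong (y +_) (m+[n∸m]≡n x<k) ⟩
      y + k                         ∎
      where open ≡-Reasoning

  pairAtDistance : ∀ M → Acc _<_ M → 0 < M → ∀ {x y} → x < k → y < k → PairAtDistance M x y
  pairAtDistance M (acc rs) 0<M {x} {y} x<k y<k with k ≤? M
  ... | no  M≱k = pairAtDistance-within 0<M (<⇒≤ (≰⇒> M≱k)) x<k (adjacentPair (m%n<n (x + M) k) y<k)
  ... | yes k≤M = subst (λ z → PairAtDistance z x y) (sym (j≡k*[j/k]+j%k M))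
      (pairAtDistance-scale (m%n<n M k) y<k
        (pairAtDistance (M / k) (rs M/k<M) (m≥n⇒m/n>0 k≤M) x<k (m%n<n (y + (k ∸ M % k)) k)))
    where
    instance _ = >-nonZero 0<M
    M/k<M : M / k < M
    M/k<M = m/n<m M k 1<k

  profile-realized : ∀ n {a x y} → a < k → x < k → y < k →
    ∃ λ i → ψ k (factor t i n) ≡ profile n (a , x , y)
  profile-realized n {a} {x} {y} a<k x<k y<k = realized ((a + n) / k) refl
    where
    open ≡-Reasoning
    realized : ∀ M → (a + n) / k ≡ M → ∃ λ i → ψ k (factor t i n) ≡ profile n (a , x , y)
    realized zero    crossings = k * x + a , (begin
      ψ k (factor t (k * x + a) n)                 ≡⟨ ψ-factor x n a<k ⟩
      profile n (a , t x , t (x + (a + n) / k))    ≡⟨ profile-unchanged n crossings ⟩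
      profile n (a , t x , y)                      ≡⟨ cong (λ z → profile n (a , z , y)) (tm-small x<k) ⟩
      profile n (a , x , y)                        ∎)
    realized (suc M) crossings =
      let q , tq≡x , t[q+1+M]≡y = pairAtDistance (suc M) (<-wellFounded (suc M)) z<s x<k y<k
      in k * q + a , (begin
      ψ k (factor t (k * q + a) n)                 ≡⟨ ψ-factor q n a<k ⟩
      profile n (a , t q , t (q + (a + n) / k))
        ≡⟨ cong₂ (λ u v → profile n (a , u , t (q + v))) tq≡x crossings ⟩
      profile n (a , x , t (q + suc M))            ≡⟨ cong (λ z → profile n (a , x , z)) t[q+1+M]≡y ⟩
      profile n (a , x , y)                        ∎)

  triples : List (ℕ × ℕ × ℕ)
  triples = cartesianProduct (upTo k) (cartesianProduct (upTo k) (upTo k))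

  parikhVectors : ℕ → List (List ℕ)
  parikhVectors n = deduplicate (≡-dec _≟_) (map (profile n) triples)

  parikhVectors-complete : ∀ n i → ψ k (factor t i n) ∈ parikhVectors n
  parikhVectors-complete n i = subst (_∈ parikhVectors n) (sym ψ≡)
    (∈-deduplicate⁺ (≡-dec _≟_) (∈-map⁺ (profile n)
      (∈-cartesianProduct⁺ (∈-upTo⁺ a<k)
        (∈-cartesianProduct⁺ (∈-upTo⁺ (tm<k q)) (∈-upTo⁺ (tm<k (q + (a + n) / k)))))))
    where
    q = i / k
    a = i % k
    a<k : a < k
    a<k = m%n<n i k
    ψ≡ : ψ k (factor t i n) ≡ profile n (a , t q , t (q + (a + n) / k))
    ψ≡ = trans (cong (λ z → ψ k (factor t z n)) (j≡k*[j/k]+j%k i)) (ψ-factor q n a<k)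

  parikhVectors-sound : ∀ n p → p ∈ parikhVectors n → ∃ λ i → ψ k (factor t i n) ≡ p
  parikhVectors-sound n p p∈
    with (a , x , y) , u∈ , p≡ ← ∈-map⁻ (profile n) (∈-deduplicate⁻ (≡-dec _≟_) _ p∈)
    with a∈ , xy∈ ← ∈-cartesianProduct⁻ (upTo k) _ u∈
    with x∈ , y∈ ← ∈-cartesianProduct⁻ (upTo k) (upTo k) xy∈
    with i , ψ≡ ← profile-realized n (∈-upTo⁻ a∈) (∈-upTo⁻ x∈) (∈-upTo⁻ y∈)
    = i , trans ψ≡ (sym p≡)

  abelianComplexity : ∀ n → IsAbelianComplexity k t n (length (parikhVectors n))
  abelianComplexity n = parikhVectors n , deduplicate-! (map (profile n) triples) , refl
                      , parikhVectors-complete n , parikhVectors-sound n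

  crossing-+k : ∀ {M} → 0 < M → ∀ a n b x y c →
    crossing a (n + k) (suc M) b x y c ≡ suc (crossing a n M b x y c)
  crossing-+k {suc M} _ a n b x y c = +-suc (countAscending (x + a) (k ∸ a) c) (M + countAscending y b c)

  profile-+k : ∀ n → k ≤ n → ∀ u → profile (n + k) u ≡ map suc (profile n u)
  profile-+k n k≤n (a , x , y) = begin
    map (crossing a (n + k) ((a + (n + k)) / k) ((a + (n + k)) % k) x y) (upTo k)
      ≡⟨ cong₂ (λ M b → map (crossing a (n + k) M b x y) (upTo k)) M≡ b≡ ⟩
    map (crossing a (n + k) (suc M) b x y) (upTo k)
      ≡⟨ map-cong (crossing-+k (m≥n⇒m/n>0 (≤-trans k≤n (m≤n+m n a))) a n b x y) (upTo k) ⟩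
    map (suc ∘ crossing a n M b x y) (upTo k)
      ≡⟨ map-∘ (upTo k) ⟩
    map suc (profile n (a , x , y)) ∎
    where
    open ≡-Reasoning
    M = (a + n) / k
    b = (a + n) % k
    M≡ : (a + (n + k)) / k ≡ suc M
    M≡ = begin
      (a + (n + k)) / k           ≡⟨ cong (_/ k) (+-assoc a n k) ⟨
      (a + n + k) / k             ≡⟨ m/n≡1+[m∸n]/n (m≤n+m k (a + n)) ⟩
      suc ((a + n + k ∸ k) / k)   ≡⟨ cong (λ z → suc (z / k)) (m+n∸n≡m (a + n) k) ⟩
      suc M                       ∎
    b≡ : (a + (n + k)) % k ≡ b
    b≡ = trans (cong (_% k) (sym (+-assoc a n k))) ([m+n]%n≡m%n (a + n) k)

  parikhVectors-+k : ∀ n → k ≤ n → parikhVectors (n + k) ≡ map (map suc) (parikhVectors n)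
  parikhVectors-+k n k≤n = begin
    deduplicate (≡-dec _≟_) (map (profile (n + k)) triples)
      ≡⟨ cong (deduplicate (≡-dec _≟_)) profiles≡ ⟩
    deduplicate (≡-dec _≟_) (map (map suc) (map (profile n) triples))
      ≡⟨ deduplicate-map-injective (≡-dec _≟_) (≡-dec _≟_) (map-injective suc-injective) _ ⟩
    map (map suc) (parikhVectors n)
      ∎
    where
    open ≡-Reasoning
    profiles≡ : map (profile (n + k)) triples ≡ map (map suc) (map (profile n) triples)
    profiles≡ = trans (map-cong (profile-+k n k≤n) triples) (map-∘ triples)

  length-parikhVectors-+k : ∀ n → k ≤ n → length (parikhVectors (n + k)) ≡ length (parikhVectors n)
  length-parikhVectors-+k n k≤n =
    trans (cong length (parikhVectors-+k n k≤n)) (length-map (map suc) (parikhVectors n))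

corollary1 : (k : ℕ) → .{{_ : NonZero k}} → 2 ≤ k →
    Σ (ℕ → ℕ) λ ρ →
      (∀ n → 1 ≤ n → IsAbelianComplexity k (tm k) n (ρ n))
      × (∃ λ N → ∀ n → N ≤ n → ρ (n + k) ≡ ρ n)
corollary1 k 2≤k = length ∘ parikhVectors , (λ n _ → abelianComplexity n) , (k , length-parikhVectors-+k)
  where open ThueMorse k 2≤k
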